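{- Let $g,m$ be positive integers. If $g\mid m$ and $s_g(m)\ge g$, then $1<g<m^{1/(\operatorname{ord}_g(m)+1)}\le\sqrt m$.
   Context: For an integer base $g\ge2$ and integer $m\ge0$, $s_g(m)$ is the sum of the base-$g$ digits of $m$; by convention $s_1(m):=0$. For integers $g\ge2$, $m\ge1$, $\operatorname{ord}_g(m):=\max\{n\ge0:g^n\mid m\}$. -}

module Defs where

open import Data.Nat using (ℕ; zero; suc; _+_; _%_; _/_)
open import Data.Nat.Divisibility using (_∣?_)
open import Relation.Nullary using (yes; no)

-- s g m : sum of base-g digits of m (g ≥ 2); convention s_1(m) = 0 (and s_0 := 0, unused).
-- Fuel m suffices since m / g < m for m ≥ 1, g ≥ 2.
s : ℕ → ℕ → ℕ
s zero          m = 0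
s (suc zero)    m = 0
s (suc (suc h)) m = go m m
  where
  go : ℕ → ℕ → ℕ
  go zero    x = x % suc (suc h)
  go (suc f) x = x % suc (suc h) + go f (x / suc (suc h))

-- ord g m = max { n ≥ 0 : g^n ∣ m }, for g ≥ 2 and m ≥ 1
-- (computed by repeated division; fuel m suffices since g^n ∣ m ⇒ n < m).
-- Values for g ≤ 1 or m = 0 are junk (0) and never used.
ord : ℕ → ℕ → ℕ
ord zero          m = 0
ord (suc zero)    m = 0
ord (suc (suc h)) m = go m m
  where
  go : ℕ → ℕ → ℕ
  go zero    x = 0
  go (suc f) zero = 0
  go (suc f) (suc y) with suc (suc h) ∣? suc y
  ... | yes _ = suc (go f (suc y / suc (suc h)))
  ... | no  _ = 0

{-# OPTIONS --safe #-}
module Submission where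

open import Defs
open import Data.Nat using (ℕ; zero; suc; _<_; _≤_; _≥_; _^_; _+_; _*_; _%_; _/_; z≤n; s≤s; >-nonZero)
open import Data.Nat.Properties
open import Data.Nat.DivMod using (m*n%n≡0; m*n/n≡m; m<n⇒m%n≡m; m<n⇒m/n≡0; m*[n/m]≡n; m/n<m; m≥n⇒m/n>0)
open import Data.Nat.Divisibility using (_∣_; _∣?_; _∤_; ∣⇒≤; ∣-refl)
open import Data.Product using (_×_; _,_; ∃-syntax)
open import Relation.Nullary using (yes; no; contradiction)
open import Relation.Binary.PropositionalEquality using (_≡_; _≢_; refl; sym; trans; cong; cong₂; subst; module ≡-Reasoning)

-- Write m = g^ord · r with g ∤ r. If r < g, the base-g expansion of m is the single digit r
-- followed by zeros, so s_g(m) = r < g. Hence s_g(m) ≥ g forces r ≥ g, and r ≠ g as g ∤ r, so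
-- g^(ord+1) < g^ord · r = m. The bound m² ≤ m^(ord+1) only says ord ≥ 1, i.e. g ∣ m.

-- The `where`-bound helpers `go` of Defs.s and Defs.ord have no name outside Defs. s-go h and
-- ord-go h denote them for the base 2 + h (arguments: the number analysed, unused; the fuel; the
-- current value). Each is solved by unification against the unfolding lemma in its mutual block,
-- whose with-abstraction turns the arguments of `go` into variables; afterwards
-- s (2 + h) n ≡ s-go h n n n and ord (2 + h) n ≡ ord-go h n n n hold by refl.
mutual
  s-go : ℕ → ℕ → ℕ → ℕ → ℕ
  s-go = _

  s-unfold : ∀ h y → s (2 + h) (suc y) ≡ suc y % (2 + h) + s-go h (suc y) y (suc y / (2 + h))
  s-unfold h y with suc y / (2 + h) | suc y
  ... | _ | _ = refl

mutual
  ord-go : ℕ → ℕ → ℕ → ℕ → ℕ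
  ord-go = _

  ord-unfold-∣ : ∀ h y → 2 + h ∣ suc y → ord (2 + h) (suc y) ≡ suc (ord-go h (suc y) y (suc y / (2 + h)))
  ord-unfold-∣ h y g∣x with 2 + h ∣? suc y
  ... | no g∤x = contradiction g∣x g∤x
  ... | yes _ with suc y / (2 + h) | suc y
  ...   | _ | _ = refl

module Base (h : ℕ) where

  g : ℕ
  g = 2 + h

  g^1+k*r≡g^k*r*g : ∀ k r → g ^ suc k * r ≡ g ^ k * r * g
  g^1+k*r≡g^k*r*g k r = trans (*-assoc g (g ^ k) r) (*-comm g (g ^ k * r))

  s-go-zero : ∀ n f → s-go h n f 0 ≡ 0
  s-go-zero n zero    = refl
  s-go-zero n (suc f) = s-go-zero n f

  s-go-digit : ∀ n f {r} → r < g → s-go h n f r ≡ r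
  s-go-digit n zero    r<g = m<n⇒m%n≡m r<g
  s-go-digit n (suc f) {r} r<g
    rewrite m<n⇒m%n≡m {g} {r} r<g | m<n⇒m/n≡0 {r} {g} r<g | s-go-zero n f = +-identityʳ r

  s-go-shift : ∀ n f x → s-go h n (suc f) (x * g) ≡ s-go h n f x
  s-go-shift n f x = cong₂ _+_ (m*n%n≡0 x g) (cong (s-go h n f) (m*n/n≡m x g))

  s-go-pow*digit-≤ : ∀ n f k {r} → r < g → s-go h n f (g ^ k * r) ≤ r
  s-go-pow*digit-≤ n f       zero    {r} r<g rewrite *-identityˡ r = ≤-reflexive (s-go-digit n f r<g)
  s-go-pow*digit-≤ n zero    (suc k) {r} r<g rewrite g^1+k*r≡g^k*r*g k r =
    subst (_≤ r) (sym (m*n%n≡0 (g ^ k * r) g)) z≤n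
  s-go-pow*digit-≤ n (suc f) (suc k) {r} r<g rewrite g^1+k*r≡g^k*r*g k r =
    subst (_≤ r) (sym (s-go-shift n f (g ^ k * r))) (s-go-pow*digit-≤ n f k r<g)

  s-pow*digit-≤ : ∀ k {r} → r < g → s g (g ^ k * r) ≤ r
  s-pow*digit-≤ k {r} = s-go-pow*digit-≤ (g ^ k * r) (g ^ k * r) k

  ord-go-factor : ∀ n f x → 1 ≤ x → x ≤ f → ∃[ r ] x ≡ g ^ ord-go h n f x * r × g ∤ r
  ord-go-factor n (suc f) (suc y) _ (s≤s y≤f) with g ∣? suc y
  ... | no g∤x = suc y , sym (*-identityˡ (suc y)) , g∤x
  ... | yes g∣x with ord-go-factor n f (suc y / g) (m≥n⇒m/n>0 (∣⇒≤ g∣x)) x/g≤f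
    where x/g≤f = ≤-trans (<⇒≤pred (m/n<m (suc y) g (s≤s (s≤s z≤n)))) y≤f
  ...   | r , x/g≡ , g∤r = r , x≡ , g∤r
    where
    open ≡-Reasoning
    x≡ : suc y ≡ g ^ suc (ord-go h n f (suc y / g)) * r
    x≡ = begin
      suc y                              ≡⟨ sym (m*[n/m]≡n g∣x) ⟩
      g * (suc y / g)                    ≡⟨ cong (g *_) x/g≡ ⟩
      g * (g ^ ord-go h n f (suc y / g) * r) ≡⟨ sym (*-assoc g (g ^ ord-go h n f (suc y / g)) r) ⟩
      g ^ suc (ord-go h n f (suc y / g)) * r ∎

  ord-factor : ∀ n → 1 ≤ n → ∃[ r ] n ≡ g ^ ord g n * r × g ∤ r
  ord-factor n 1≤n = ord-go-factor n n n 1≤n ≤-refl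

  ord-pos : ∀ {n} → 1 ≤ n → g ∣ n → 1 ≤ ord g n
  ord-pos {suc y} _ g∣n rewrite ord-unfold-∣ h y g∣n = s≤s z≤n

  base<cofactor : ∀ k {r} → g ≤ s g (g ^ k * r) → g ∤ r → g < r
  base<cofactor k {r} g≤s g∤r = ≤∧≢⇒< g≤r g≢r
    where
    g≤r : g ≤ r
    g≤r = ≮⇒≥ λ r<g → <⇒≱ (≤-<-trans (s-pow*digit-≤ k r<g) r<g) g≤s
    g≢r : g ≢ r
    g≢r g≡r = g∤r (subst (g ∣_) g≡r ∣-refl)

  g^k+1<g^k*r : ∀ k {r} → g < r → g ^ (k + 1) < g ^ k * r
  g^k+1<g^k*r k {r} g<r = begin-strict
    g ^ (k + 1)   ≡⟨ ^-distribˡ-+-* g k 1 ⟩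
    g ^ k * g ^ 1 ≡⟨ cong (g ^ k *_) (*-identityʳ g) ⟩
    g ^ k * g     <⟨ *-monoʳ-< (g ^ k) {{>-nonZero (m^n>0 g k)}} g<r ⟩
    g ^ k * r     ∎
    where open ≤-Reasoning

lemma6p1 : (g m : ℕ) → 1 ≤ g → 1 ≤ m → g ∣ m → s g m ≥ g →
    (1 < g) × (g ^ (ord g m + 1) < m) × (m ^ 2 ≤ m ^ (ord g m + 1))
lemma6p1 (suc zero)    m _ _   _   ()
lemma6p1 (suc (suc h)) m _ 1≤m g∣m g≤s with Base.ord-factor h m 1≤m
... | r , m≡g^k*r , g∤r = s≤s (s≤s z≤n) , g^k+1<m , m²≤m^k+1
  where
  open Base h using (g; base<cofactor; g^k+1<g^k*r; ord-pos)
  k = ord g m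

  g<r : g < r
  g<r = base<cofactor k (subst (λ n → g ≤ s g n) m≡g^k*r g≤s) g∤r

  g^k+1<m : g ^ (k + 1) < m
  g^k+1<m = subst (g ^ (k + 1) <_) (sym m≡g^k*r) (g^k+1<g^k*r k g<r)

  m²≤m^k+1 : m ^ 2 ≤ m ^ (k + 1)
  m²≤m^k+1 = ^-monoʳ-≤ m {{>-nonZero 1≤m}} (+-monoˡ-≤ 1 (ord-pos 1≤m g∣m))
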